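{- Fix $k\ge2$ and let $\pi$ be a permutation containing a decreasing subsequence of length $k$, with A-sequence $A=a_k\cdots a_1$ and B-sequence $B=b_k\cdots b_1$. If $A$ and $B$ have a letter in common but do not coincide, then $A$ contains more letters than $B$ after (to the right of) their common letters, and $B$ contains more letters than $A$ before (to the left of) their common letters. In particular, if $a_1$ belongs to $B$ or $b_k$ belongs to $A$, then $A$ and $B$ coincide.
   Context: Letters of $\pi$ are identified with their values. The A-sequence $a_k\cdots a_1$ is the lexicographically smallest (as a sequence of values read left to right) decreasing subsequence of $\pi$ of length $k$. The B-sequence $b_k\cdots b_1$ is defined recursively: $b_1$ is the leftmost letter that is the last letter of a decreasing subsequence of length $k$, and for $j\ge2$, $b_j$ is the leftmost letter such that $b_j\cdots b_1$ is a suffix of a decreasing subsequence of length $k$. The common letters of $A$ and $B$ form a contiguous segment of each sequence. -}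

module Defs where

open import Data.Nat using (ℕ)
open import Data.Fin using (Fin; _<_; _≤_; _<?_)
open import Data.Fin.Properties using (all?; _≟_)
open import Data.List using (List; length; filter)
open import Data.List using (allFin)
open import Data.Product using (∃; Σ; _×_; _,_)
open import Data.Sum using (_⊎_)
open import Function.Definitions using (Injective)
open import Relation.Binary.PropositionalEquality using (_≡_)
open import Relation.Nullary using (Dec)
open import Relation.Nullary.Decidable using (_→-dec_)

-- A permutation of {0,…,n-1}: an injective map Fin n → Fin n
-- (position ↦ value).  Letters are identified with their values.
record Perm (n : ℕ) : Set where
  field
    fun : Fin n → Fin n
    inj : Injective _≡_ _≡_ fun
open Perm public

-- A decreasing subsequence of π of length k, indexed 0,…,k-1 from LEFT
-- to right: index m corresponds to the paper's letter with subscript k-m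
-- (so index 0 is a_k / b_k and index k-1 is a_1 / b_1).
record DecSub {n : ℕ} (π : Perm n) (k : ℕ) : Set where
  field
    pos  : Fin k → Fin n
    incr : ∀ i j → i < j → pos i < pos j
    decr : ∀ i j → i < j → fun π (pos j) < fun π (pos i)
open DecSub public

val : ∀ {n k} {π : Perm n} → DecSub π k → Fin k → Fin n
val {π = π} s i = fun π (pos s i)

_≤lex_ : ∀ {n k} → (Fin k → Fin n) → (Fin k → Fin n) → Set
v ≤lex w = (∀ i → v i ≡ w i)
         ⊎ ∃ λ i → (∀ j → j < i → v j ≡ w j) × v i < w i

IsASeq : ∀ {n k} (π : Perm n) → DecSub π k → Set
IsASeq {k = k} π a = ∀ (t : DecSub π k) → val a ≤lex val t

-- B is the B-sequence: for each index m (the paper's b_{k-m}), pos B m is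
-- the leftmost position that occurs at index m in a decreasing
-- subsequence of length k whose entries after index m agree with B
-- (i.e. b_{k-m} ⋯ b_1 is a suffix of a decreasing subsequence of length k).
IsBSeq : ∀ {n k} (π : Perm n) → DecSub π k → Set
IsBSeq {k = k} π b =
  ∀ (m : Fin k) (t : DecSub π k) →
    (∀ j → m < j → val t j ≡ val b j) → pos b m ≤ pos t m

RightOfCommon : ∀ {n k} {π : Perm n} (S T : DecSub π k) → Fin k → Set
RightOfCommon S T i = ∀ i' j' → val S i' ≡ val T j' → pos S i' < pos S i

LeftOfCommon : ∀ {n k} {π : Perm n} (S T : DecSub π k) → Fin k → Set
LeftOfCommon S T i = ∀ i' j' → val S i' ≡ val T j' → pos S i < pos S i'

rightOfCommon? : ∀ {n k} {π : Perm n} (S T : DecSub π k) (i : Fin k) →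
                 Dec (RightOfCommon S T i)
rightOfCommon? S T i =
  all? λ i' → all? λ j' → (val S i' ≟ val T j') →-dec (pos S i' <? pos S i)

leftOfCommon? : ∀ {n k} {π : Perm n} (S T : DecSub π k) (i : Fin k) →
                Dec (LeftOfCommon S T i)
leftOfCommon? S T i =
  all? λ i' → all? λ j' → (val S i' ≟ val T j') →-dec (pos S i <? pos S i')

#after : ∀ {n k} {π : Perm n} (S T : DecSub π k) → ℕ
#after {k = k} S T = length (filter (rightOfCommon? S T) (allFin k))

#before : ∀ {n k} {π : Perm n} (S T : DecSub π k) → ℕ
#before {k = k} S T = length (filter (leftOfCommon? S T) (allFin k))

-- Draw π as the points (position, value); decreasing subsequences of length k are chains of k
-- points, each strictly to the lower right of the previous one.  The A-sequence is chosen
-- greedily from the left (least values), the B-sequence greedily from the right (least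
-- positions), and reflecting the diagram in its diagonal while reading chains backwards
-- exchanges the two.  If the m-th letters of A and B coincide, so do the (m+1)-th: otherwise
-- exchanging tails of A and B shows that every later letter of A stays strictly below and to
-- the left of the corresponding letter of B, so that a_1 ends up to the left of b_1,
-- contradicting the choice of b_1.  By the reflection the same holds backwards, so A and B
-- sharing a letter at the same index coincide.  Splicing a prefix of A onto a suffix of B
-- shows that a common letter is not further right in A than in B, since a chain of more than
-- k points starting at a_k would produce a decreasing subsequence lexicographically below A.
-- So when A ≠ B every common letter sits strictly further left in A than in B; this gives both
-- inequalities, and rules out a_1 or b_k being common.

module Submission where

open import Defs
open import Data.Nat using (ℕ; suc; _<_)
open import Data.Fin using (Fin; zero; fromℕ)
open import Data.Product using (∃; ∃₂; _×_)
open import Data.Sum using (_⊎_)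
open import Relation.Binary.PropositionalEquality using (_≡_)
open import Relation.Nullary using (¬_)

open import Data.Empty using (⊥; ⊥-elim)
open import Data.Fin using (toℕ)
import Data.Fin as Fin
import Data.Fin.Properties as Finₚ
open import Data.List using ([]; _∷_; length; filter; allFin)
open import Data.List.Extrema.Nat
  using (argmax; argmin; argmax-all; argmin-all; f[xs]≤f[argmax]; f[argmin]≤f[xs])
open import Data.List.Membership.Propositional using (_∈_)
open import Data.List.Membership.Propositional.Properties using (∈-filter⁺; ∈-allFin)
open import Data.List.Properties using (filter-notAll)
import Data.List.Relation.Unary.All as All
open import Data.List.Relation.Unary.All.Properties using (all-filter)
import Data.List.Relation.Unary.Any as Any
open import Data.Nat using (zero; _≤_; _+_; _∸_; z≤n; s≤s; z<s; _≤?_)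
open import Data.Nat.Properties
open import Data.Product using (_,_; proj₁; proj₂; swap)
open import Data.Sum using (inj₁; inj₂)
open import Function using (_∘_)
open import Relation.Binary.Definitions using (tri<; tri≈; tri>)
open import Relation.Binary.PropositionalEquality
  using (refl; sym; trans; cong; subst; subst₂; module ≡-Reasoning)
open import Relation.Nullary using (yes; no)
open import Relation.Nullary.Decidable using (decidable-stable)
open import Relation.Unary using (Pred; Decidable; _⊆_)

module _ {a p q} {A : Set a} {P : Pred A p} {Q : Pred A q}
         (P? : Decidable P) (Q? : Decidable Q) (P⊆Q : P ⊆ Q) where

  filter-absorb : ∀ xs → filter P? (filter Q? xs) ≡ filter P? xs
  filter-absorb []       = refl
  filter-absorb (x ∷ xs) with Q? x
  ... | yes _ with P? x
  ...   | yes _ = cong (x ∷_) (filter-absorb xs)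
  ...   | no _  = filter-absorb xs
  filter-absorb (x ∷ xs) | no ¬qx with P? x
  ...   | yes px = ⊥-elim (¬qx (P⊆Q px))
  ...   | no _   = filter-absorb xs

  length-filter-< : ∀ {x xs} → x ∈ xs → Q x → ¬ P x →
                    length (filter P? xs) < length (filter Q? xs)
  length-filter-< {x} {xs} x∈xs qx ¬px =
    subst (λ ys → length ys < length (filter Q? xs)) (filter-absorb xs)
      (filter-notAll P? (filter Q? xs) (Any.map (λ { refl → ¬px }) (∈-filter⁺ Q? x∈xs qx)))

module _ {k ℓ} {P : Pred (Fin k) ℓ} (P? : Decidable P) where

  greatest-satisfying : ∀ {j} → P j → ∃ λ m → P m × (∀ {j′} → P j′ → j′ Fin.≤ m)
  greatest-satisfying {j} pj =
    argmax toℕ j xs , argmax-all toℕ pj (all-filter P? (allFin k)) ,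
    λ pj′ → All.lookup (f[xs]≤f[argmax] j xs) (∈-filter⁺ P? (∈-allFin _) pj′)
    where xs = filter P? (allFin k)

  least-satisfying : ∀ {j} → P j → ∃ λ m → P m × (∀ {j′} → P j′ → m Fin.≤ j′)
  least-satisfying {j} pj =
    argmin toℕ j xs , argmin-all toℕ pj (all-filter P? (allFin k)) ,
    λ pj′ → All.lookup (f[argmin]≤f[xs] j xs) (∈-filter⁺ P? (∈-allFin _) pj′)
    where xs = filter P? (allFin k)

record Diagram : Set₁ where
  field
    Point       : Set
    x y         : Point → ℕ
    x-injective : ∀ {u v} → x u ≡ x v → u ≡ v
    y-injective : ∀ {u v} → y u ≡ y v → u ≡ v

transpose : Diagram → Diagram
transpose D = record
  { Point = Point ; x = y ; y = x ; x-injective = y-injective ; y-injective = x-injective }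
  where open Diagram D

module _ {X : Set} where

  _⟨_⟩_ : (ℕ → X) → ℕ → (ℕ → X) → ℕ → X
  (f ⟨ h ⟩ g) m with m ≤? h
  ... | yes _ = f m
  ... | no _  = g m

  splice-≤ : ∀ {f g : ℕ → X} {h m} → m ≤ h → (f ⟨ h ⟩ g) m ≡ f m
  splice-≤ {h = h} {m} m≤h with m ≤? h
  ... | yes _  = refl
  ... | no m≰h = ⊥-elim (m≰h m≤h)

  splice-> : ∀ {f g : ℕ → X} {h m} → h < m → (f ⟨ h ⟩ g) m ≡ g m
  splice-> {h = h} {m} h<m with m ≤? h
  ... | yes m≤h = ⊥-elim (<⇒≱ h<m m≤h)
  ... | no _    = refl

  delay : ℕ → (ℕ → X) → ℕ → X
  delay d f m = f (m ∸ d)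

  rev : ℕ → (ℕ → X) → ℕ → X
  rev K f m = f (K ∸ m)

module Chains (D : Diagram) where
  open Diagram D

  infix 4 _↘_
  _↘_ : Point → Point → Set
  u ↘ v = x u < x v × y v < y u

  ↘-trans : ∀ {u v w} → u ↘ v → v ↘ w → u ↘ w
  ↘-trans (xu<xv , yv<yu) (xv<xw , yw<yv) = <-trans xu<xv xv<xw , <-trans yw<yv yv<yu

  -- Chain K g consists of the K + 1 points g 0, …, g K.
  ChainOn : (ℕ → Point) → ℕ → ℕ → Set
  ChainOn g lo hi = ∀ m → lo ≤ m → m < hi → g m ↘ g (suc m)

  Chain : ℕ → (ℕ → Point) → Set
  Chain K g = ChainOn g 0 K

  chainOn-↘ : ∀ {g lo hi m m′} → ChainOn g lo hi → lo ≤ m → m < m′ → m′ ≤ hi →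
              g m ↘ g m′
  chainOn-↘ {m′ = suc m′} c lo≤m (s≤s m≤m′) m′<hi with m≤n⇒m<n∨m≡n m≤m′
  ... | inj₂ refl = c m′ lo≤m m′<hi
  ... | inj₁ m<m′ = ↘-trans (chainOn-↘ c lo≤m m<m′ (<⇒≤ m′<hi))
                            (c m′ (≤-trans lo≤m (<⇒≤ m<m′)) m′<hi)

  chainOn-restrict : ∀ {g lo hi lo′ hi′} → ChainOn g lo hi → lo ≤ lo′ → hi′ ≤ hi →
                     ChainOn g lo′ hi′
  chainOn-restrict c lo≤lo′ hi′≤hi m lo′≤m m<hi′ =
    c m (≤-trans lo≤lo′ lo′≤m) (<-≤-trans m<hi′ hi′≤hi)

  chainOn-splice : ∀ {f g lo h hi} → ChainOn f lo h → ChainOn g (suc h) hi →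
                   f h ↘ g (suc h) → ChainOn (f ⟨ h ⟩ g) lo hi
  chainOn-splice {f} {g} {h = h} cf cg f↘g m lo≤m m<hi with <-cmp m h
  ... | tri< m<h _ _ =
    subst₂ _↘_ (sym (splice-≤ {f = f} {g} (<⇒≤ m<h))) (sym (splice-≤ {f = f} {g} m<h)) (cf m lo≤m m<h)
  ... | tri≈ _ refl _ =
    subst₂ _↘_ (sym (splice-≤ {f = f} {g} {h} ≤-refl)) (sym (splice-> {f = f} {g} (n<1+n h))) f↘g
  ... | tri> _ _ h<m =
    subst₂ _↘_ (sym (splice-> {f = f} {g} h<m)) (sym (splice-> {f = f} {g} (m<n⇒m<1+n h<m)))
      (cg m h<m m<hi)

  chainOn-delay : ∀ {g lo hi} d → ChainOn g lo hi → ChainOn (delay d g) (d + lo) (d + hi)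
  chainOn-delay {g} {lo} {hi} d c m d+lo≤m m<d+hi =
    subst (λ t → g (m ∸ d) ↘ g t) (sym (+-∸-assoc 1 d≤m)) (c (m ∸ d) lo≤m∸d m∸d<hi)
    where
    d≤m : d ≤ m
    d≤m = ≤-trans (m≤m+n d lo) d+lo≤m
    lo≤m∸d : lo ≤ m ∸ d
    lo≤m∸d = m+n≤o⇒m≤o∸n lo (subst (_≤ m) (+-comm d lo) d+lo≤m)
    m∸d<hi : m ∸ d < hi
    m∸d<hi = subst (m ∸ d <_) (m+n∸m≡n d hi) (∸-monoˡ-< m<d+hi d≤m)

  -- The A-sequence property (values lexicographically least, read from the left) and the
  -- B-sequence property (positions lexicographically least, read from the right).
  YGreedy : ℕ → (ℕ → Point) → Set
  YGreedy K a = ∀ {g} h → Chain K g → h ≤ K → (∀ m → m < h → g m ≡ a m) →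
                y (a h) ≤ y (g h)

  XGreedy : ℕ → (ℕ → Point) → Set
  XGreedy K b = ∀ {g} h → Chain K g → h ≤ K → (∀ m → h < m → m ≤ K → g m ≡ b m) →
                x (b h) ≤ x (g h)

record ABPair (D : Diagram) (K : ℕ) : Set where
  open Diagram D
  open Chains D
  field
    a b      : ℕ → Point
    a-chain  : Chain K a
    b-chain  : Chain K b
    a-greedy : YGreedy K a
    b-greedy : XGreedy K b

module Exchange {D : Diagram} {K : ℕ} (E : ABPair D K) where
  open Diagram D
  open Chains D
  open ABPair E

  a₀-below-longer : ∀ {g} → Chain (suc K) g → y (a 0) < y (g 0)
  a₀-below-longer {g} c =
    ≤-<-trans (a-greedy {g ∘ suc} 0 tail z≤n (λ _ ())) (proj₂ (c 0 z≤n z<s))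
    where
    tail : Chain K (g ∘ suc)
    tail m _ m<K = c (suc m) z≤n (s≤s m<K)

  a-prefix-unextendable : ∀ {i g} → i ≤ K → ChainOn g (suc i) (suc K) → a i ↘ g (suc i) →
                          ⊥
  a-prefix-unextendable {i} {g} i≤K cg a↘g =
    <-irrefl (cong y (sym (splice-≤ {f = a} {g} {i} z≤n))) (a₀-below-longer c)
    where
    c : Chain (suc K) (a ⟨ i ⟩ g)
    c = chainOn-splice (chainOn-restrict a-chain ≤-refl i≤K) cg a↘g

  crossover : ∀ {h} → h < K → a h ↘ b (suc h) →
              y (a (suc h)) ≤ y (b (suc h)) × x (b h) ≤ x (a h)
  crossover {h} h<K a↘b =
    subst (λ t → y (a (suc h)) ≤ y t) (splice-> {f = a} {b} (n<1+n h))
      (a-greedy (suc h) c h<K (λ m m<1+h → splice-≤ (≤-pred m<1+h))) ,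
    subst (λ t → x (b h) ≤ x t) (splice-≤ {f = a} {b} ≤-refl)
      (b-greedy h c (<⇒≤ h<K) (λ m h<m _ → splice-> h<m))
    where
    c : Chain K (a ⟨ h ⟩ b)
    c = chainOn-splice (chainOn-restrict a-chain ≤-refl (<⇒≤ h<K))
                       (chainOn-restrict b-chain z≤n ≤-refl) a↘b

  -- For j < i, a 0 … a i followed by b (j+1) … b K would have more than K + 1 points.
  common-index-≤ : ∀ {i j} → i ≤ K → a i ≡ b j → i ≤ j
  common-index-≤ {i} {j} i≤K aᵢ≡bⱼ =
    ≮⇒≥ λ j<i → a-prefix-unextendable i≤K (cg j<i) (a↘g j<i)
    where
    g : ℕ → Point
    g = delay (i ∸ j) b
    cg : j < i → ChainOn g (suc i) (suc K)
    cg j<i = chainOn-restrict (chainOn-delay (i ∸ j) (chainOn-restrict b-chain z≤n ≤-refl))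
               (≤-reflexive (trans (+-suc (i ∸ j) j) (cong suc (m∸n+n≡m (<⇒≤ j<i)))))
               (+-monoˡ-≤ K (m<n⇒0<n∸m j<i))
    a↘g : j < i → a i ↘ g (suc i)
    a↘g j<i = subst₂ _↘_ (sym aᵢ≡bⱼ) (cong b (sym shift))
                (b-chain j z≤n (<-≤-trans j<i i≤K))
      where
      shift : suc i ∸ (i ∸ j) ≡ suc j
      shift = trans (+-∸-assoc 1 (m∸n≤m i j)) (cong suc (m∸[m∸n]≡n (<⇒≤ j<i)))

  module _ {i} (i<K : i < K) (aᵢ≡bᵢ : a i ≡ b i) where

    below⇒left : ∀ {h} → i < h → h ≤ K → y (a h) < y (b h) → x (a h) < x (b h)
    below⇒left {h} i<h h≤K ya<yb =
      ≤∧≢⇒< (≮⇒≥ b-left) (λ e → <⇒≢ ya<yb (cong y (x-injective e)))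
      where
      -- a 0 … a i, b (i+1) … b h, a h … a K would be a chain of K + 2 points through a 0.
      b-left : x (b h) < x (a h) → ⊥
      b-left xb<xa = a-prefix-unextendable (<⇒≤ i<K) cg a↘g
        where
        g : ℕ → Point
        g = b ⟨ h ⟩ delay 1 a
        cg : ChainOn g (suc i) (suc K)
        cg = chainOn-splice (chainOn-restrict b-chain z≤n h≤K)
               (chainOn-delay 1 (chainOn-restrict a-chain z≤n ≤-refl)) (xb<xa , ya<yb)
        a↘g : a i ↘ g (suc i)
        a↘g = subst₂ _↘_ (sym aᵢ≡bᵢ) (sym (splice-≤ i<h)) (b-chain i z≤n i<K)

    below-persists : ∀ {h} → i < h → h < K → y (a h) < y (b h) →
                     y (a (suc h)) < y (b (suc h))
    below-persists {h} i<h h<K ya<yb = <-trans (proj₂ (a-chain h z≤n h<K)) yaₕ<yb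
      where
      xa<xb : x (a h) < x (b (suc h))
      xa<xb = <-trans (below⇒left i<h (<⇒≤ h<K) ya<yb) (proj₁ (b-chain h z≤n h<K))
      yaₕ<yb : y (a h) < y (b (suc h))
      yaₕ<yb = ≤∧≢⇒< (≮⇒≥ λ yb<ya → <⇒≱ (below⇒left i<h (<⇒≤ h<K) ya<yb)
                                          (proj₂ (crossover h<K (xa<xb , yb<ya))))
                     (λ e → <⇒≢ xa<xb (cong x (y-injective e)))

    below-from : y (a (suc i)) < y (b (suc i)) → ∀ {h} → i < h → h ≤ K →
                 y (a h) < y (b h)
    below-from start {suc h} (s≤s i≤h) h<K with m≤n⇒m<n∨m≡n i≤h
    ... | inj₂ refl = start
    ... | inj₁ i<h = below-persists i<h h<K (below-from start i<h (<⇒≤ h<K))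

    agree-step : a (suc i) ≡ b (suc i)
    agree-step with m≤n⇒m<n∨m≡n (proj₁ (crossover i<K aᵢ↘bᵢ₊₁))
      where
      aᵢ↘bᵢ₊₁ : a i ↘ b (suc i)
      aᵢ↘bᵢ₊₁ = subst (_↘ b (suc i)) (sym aᵢ≡bᵢ) (b-chain i z≤n i<K)
    ... | inj₂ e     = y-injective e
    ... | inj₁ below = ⊥-elim (<⇒≱ (below⇒left i<K ≤-refl (below-from below i<K ≤-refl)) b-leftmost)
      where
      b-leftmost : x (b K) ≤ x (a K)
      b-leftmost = b-greedy K a-chain ≤-refl λ _ K<m m≤K → ⊥-elim (<⇒≱ K<m m≤K)

m<K∸h⇒h<K∸m : ∀ {K m h} → h ≤ K → m < K ∸ h → h < K ∸ m
m<K∸h⇒h<K∸m {K} {m} {h} h≤K m<K∸h =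
  subst (_< K ∸ m) (m∸[m∸n]≡n h≤K) (∸-monoʳ-< m<K∸h (m∸n≤m K h))

K∸h<m⇒K∸m<h : ∀ {K m h} → h ≤ K → K ∸ h < m → m ≤ K → K ∸ m < h
K∸h<m⇒K∸m<h {K} {m} {h} h≤K K∸h<m m≤K =
  subst (K ∸ m <_) (m∸[m∸n]≡n h≤K) (∸-monoʳ-< K∸h<m m≤K)

module _ {D : Diagram} {K : ℕ} where
  open Diagram D
  open Chains D
  private module ᵀ = Chains (transpose D)

  rev-chain : ∀ {g} → Chain K g → ᵀ.Chain K (rev K g)
  rev-chain {g} c m _ m<K =
    swap (subst (λ t → g (K ∸ suc m) ↘ g t) (sym (+-∸-assoc 1 m<K))
                (c (K ∸ suc m) z≤n (∸-monoʳ-< z<s m<K)))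

module _ {D : Diagram} {K : ℕ} where
  open Diagram D
  open Chains D
  private module ᵀ = Chains (transpose D)

  rev-YGreedy : ∀ {a} → YGreedy K a → ᵀ.XGreedy K (rev K a)
  rev-YGreedy {a} greedy {g} h c h≤K agree =
    subst (λ t → y (a (K ∸ h)) ≤ y (g t)) (m∸[m∸n]≡n h≤K)
      (greedy (K ∸ h) (rev-chain {transpose D} c) (m∸n≤m K h) agree′)
    where
    agree′ : ∀ m → m < K ∸ h → rev K g m ≡ a m
    agree′ m m<K∸h = trans (agree (K ∸ m) (m<K∸h⇒h<K∸m h≤K m<K∸h) (m∸n≤m K m))
                           (cong a (m∸[m∸n]≡n (≤-trans (<⇒≤ m<K∸h) (m∸n≤m K h))))

  rev-XGreedy : ∀ {b} → XGreedy K b → ᵀ.YGreedy K (rev K b)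
  rev-XGreedy {b} greedy {g} h c h≤K agree =
    subst (λ t → x (b (K ∸ h)) ≤ x (g t)) (m∸[m∸n]≡n h≤K)
      (greedy (K ∸ h) (rev-chain {transpose D} c) (m∸n≤m K h) agree′)
    where
    agree′ : ∀ m → K ∸ h < m → m ≤ K → rev K g m ≡ b m
    agree′ m K∸h<m m≤K = trans (agree (K ∸ m) (K∸h<m⇒K∸m<h h≤K K∸h<m m≤K))
                               (cong b (m∸[m∸n]≡n m≤K))

reverse : ∀ {D K} → ABPair D K → ABPair (transpose D) K
reverse {D} {K} E = record
  { a = rev K b ; b = rev K a
  ; a-chain = rev-chain {D} b-chain ; b-chain = rev-chain {D} a-chain
  ; a-greedy = rev-XGreedy {D} b-greedy ; b-greedy = rev-YGreedy {D} a-greedy }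
  where open ABPair E

module Agreement {D : Diagram} {K : ℕ} (E : ABPair D K) where
  open ABPair E
  open Exchange E

  agree-step-back : ∀ {i} → i < K → a (suc i) ≡ b (suc i) → a i ≡ b i
  agree-step-back {i} i<K e = begin
    a i                      ≡⟨ cong a (sym back) ⟩
    a (K ∸ suc (K ∸ suc i))  ≡⟨ sym (Exchange.agree-step (reverse E) i′<K e′) ⟩
    b (K ∸ suc (K ∸ suc i))  ≡⟨ cong b back ⟩
    b i                      ∎
    where
    open ≡-Reasoning
    i′<K : K ∸ suc i < K
    i′<K = ∸-monoʳ-< z<s i<K
    e′ : b (K ∸ (K ∸ suc i)) ≡ a (K ∸ (K ∸ suc i))
    e′ = subst (λ t → b t ≡ a t) (sym (m∸[m∸n]≡n i<K)) (sym e)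
    back : K ∸ suc (K ∸ suc i) ≡ i
    back = trans (cong (K ∸_) (sym (+-∸-assoc 1 i<K))) (m∸[m∸n]≡n (<⇒≤ i<K))

  agree⇒agree₀ : ∀ h → h ≤ K → a h ≡ b h → a 0 ≡ b 0
  agree⇒agree₀ zero    _   e = e
  agree⇒agree₀ (suc h) h<K e = agree⇒agree₀ h (<⇒≤ h<K) (agree-step-back h<K e)

  agree₀⇒agree : a 0 ≡ b 0 → ∀ h → h ≤ K → a h ≡ b h
  agree₀⇒agree e zero    _   = e
  agree₀⇒agree e (suc h) h<K = agree-step h<K (agree₀⇒agree e h (<⇒≤ h<K))

  common-index-< : ¬ (∀ h → h ≤ K → a h ≡ b h) → ∀ {i j} → i ≤ K → a i ≡ b j → i < j
  common-index-< ¬agree {i} i≤K aᵢ≡bⱼ = ≤∧≢⇒< (common-index-≤ i≤K aᵢ≡bⱼ) λ { refl →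
    ¬agree (agree₀⇒agree (agree⇒agree₀ i i≤K aᵢ≡bⱼ)) }

-- clamp m = min m K, so positions S repeats the last letter of S beyond index K.
clamp : ∀ {K} → ℕ → Fin (suc K)
clamp zero          = zero
clamp {zero} (suc m)  = zero
clamp {suc K} (suc m) = Fin.suc (clamp m)

toℕ-clamp : ∀ {K m} → m ≤ K → toℕ (clamp {K} m) ≡ m
toℕ-clamp {m = zero}  _         = refl
toℕ-clamp {suc K} {suc m} (s≤s m≤K) = cong suc (toℕ-clamp m≤K)

clamp-toℕ : ∀ {K} (i : Fin (suc K)) → clamp (toℕ i) ≡ i
clamp-toℕ zero                = refl
clamp-toℕ {suc K} (Fin.suc i) = cong Fin.suc (clamp-toℕ i)

module _ {n : ℕ} (π : Perm n) where

  diagram : Diagram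
  diagram = record
    { Point = Fin n ; x = toℕ ; y = toℕ ∘ fun π
    ; x-injective = Finₚ.toℕ-injective ; y-injective = inj π ∘ Finₚ.toℕ-injective }

  open Chains diagram

  module _ {K : ℕ} where

    positions : DecSub π (suc K) → ℕ → Fin n
    positions S m = pos S (clamp m)

    positions-toℕ : ∀ S i → positions S (toℕ i) ≡ pos S i
    positions-toℕ S i = cong (pos S) (clamp-toℕ i)

    positions-chain : ∀ S → Chain K (positions S)
    positions-chain S m _ m<K = incr S _ _ clampₘ<clampₘ₊₁ , decr S _ _ clampₘ<clampₘ₊₁
      where
      clampₘ<clampₘ₊₁ : clamp {K} m Fin.< clamp (suc m)
      clampₘ<clampₘ₊₁ = subst₂ _<_ (sym (toℕ-clamp (<⇒≤ m<K))) (sym (toℕ-clamp m<K)) (n<1+n m)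

    chain⇒DecSub : ∀ {g} → Chain K g → DecSub π (suc K)
    chain⇒DecSub {g} c = record
      { pos  = g ∘ toℕ
      ; incr = λ i j i<j → proj₁ (ordered i j i<j)
      ; decr = λ i j i<j → proj₂ (ordered i j i<j) }
      where
      ordered : ∀ i j → i Fin.< j → g (toℕ i) ↘ g (toℕ j)
      ordered i j i<j = chainOn-↘ c z≤n i<j (Finₚ.toℕ≤pred[n] j)

    val-chain⇒DecSub : ∀ {g} (c : Chain K g) {h} → h ≤ K →
                       val (chain⇒DecSub c) (clamp h) ≡ fun π (g h)
    val-chain⇒DecSub {g} c h≤K = cong (fun π ∘ g) (toℕ-clamp h≤K)

    IsASeq⇒YGreedy : ∀ {A} → IsASeq π A → YGreedy K (positions A)
    IsASeq⇒YGreedy {A} isA {g} h c h≤K agree with isA (chain⇒DecSub c)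
    ... | inj₁ A≡t = ≤-reflexive (cong toℕ (trans (A≡t (clamp h)) (val-chain⇒DecSub c h≤K)))
    ... | inj₂ (i , A≡t-before-i , Aᵢ<tᵢ) with <-cmp (toℕ i) h
    ...   | tri< i<h _ _ =
      ⊥-elim (<-irrefl (cong (toℕ ∘ fun π) (sym (trans (agree (toℕ i) i<h) (positions-toℕ A i))))
                       Aᵢ<tᵢ)
    ...   | tri≈ _ refl _ =
      subst (λ p → toℕ (fun π p) ≤ toℕ (fun π (g h))) (sym (positions-toℕ A i)) (<⇒≤ Aᵢ<tᵢ)
    ...   | tri> _ _ h<i =
      ≤-reflexive (cong toℕ (trans (A≡t-before-i (clamp h) clampₕ<i) (val-chain⇒DecSub c h≤K)))
      where
      clampₕ<i : clamp h Fin.< i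
      clampₕ<i = subst (_< toℕ i) (sym (toℕ-clamp h≤K)) h<i

    IsBSeq⇒XGreedy : ∀ {B} → IsBSeq π B → XGreedy K (positions B)
    IsBSeq⇒XGreedy {B} isB {g} h c h≤K agree =
      subst (λ t → toℕ (positions B h) ≤ toℕ (g t)) (toℕ-clamp h≤K)
        (isB (clamp h) (chain⇒DecSub c) agree′)
      where
      agree′ : ∀ j → clamp h Fin.< j → fun π (g (toℕ j)) ≡ val B j
      agree′ j h<j =
        cong (fun π) (trans (agree (toℕ j) (subst (_< toℕ j) (toℕ-clamp h≤K) h<j) (Finₚ.toℕ≤pred[n] j))
                            (positions-toℕ B j))

    abPair : ∀ {A B} → IsASeq π A → IsBSeq π B → ABPair diagram K
    abPair {A} {B} isA isB = record
      { a = positions A ; b = positions B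
      ; a-chain = positions-chain A ; b-chain = positions-chain B
      ; a-greedy = IsASeq⇒YGreedy {A} isA ; b-greedy = IsBSeq⇒XGreedy {B} isB }

pos-reflects-< : ∀ {n k} {π : Perm n} (S : DecSub π k) {i j} → pos S i Fin.< pos S j → i Fin.< j
pos-reflects-< S {i} {j} pᵢ<pⱼ with <-cmp (toℕ i) (toℕ j)
... | tri< i<j _ _ = i<j
... | tri≈ _ i≡j _ = ⊥-elim (<-irrefl (cong (toℕ ∘ pos S) (Finₚ.toℕ-injective i≡j)) pᵢ<pⱼ)
... | tri> _ _ j<i = ⊥-elim (<-asym pᵢ<pⱼ (incr S _ _ j<i))

module CommonLetters {n K : ℕ} {π : Perm n} {A B : DecSub π (suc K)}
                     (isA : IsASeq π A) (isB : IsBSeq π B)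
                     (A≢B : ¬ (∀ i → val A i ≡ val B i)) where

  common-index-< : ∀ {i j} → val A i ≡ val B j → i Fin.< j
  common-index-< {i} {j} e =
    Agreement.common-index-< (abPair π {K} {A} {B} isA isB) ¬agree (Finₚ.toℕ≤pred[n] i)
      (trans (positions-toℕ π A i) (trans (inj π e) (sym (positions-toℕ π B j))))
    where
    ¬agree : ¬ (∀ h → h ≤ K → positions π A h ≡ positions π B h)
    ¬agree agree = A≢B λ i → cong (fun π) (trans (sym (positions-toℕ π A i))
                     (trans (agree (toℕ i) (Finₚ.toℕ≤pred[n] i)) (positions-toℕ π B i)))

  module _ (common : ∃₂ λ i j → val A i ≡ val B j) where

    more-after : #after B A < #after A B
    more-after with greatest-satisfying (λ j → Finₚ.any? λ i → val A i Finₚ.≟ val B j)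
                                        (proj₁ common , proj₂ (proj₂ common))
    ... | j , (i , Aᵢ≡Bⱼ) , maximal =
      length-filter-< (rightOfCommon? B A) (rightOfCommon? A B) B⇒A (∈-allFin j) A-right ¬B-right
      where
      B⇒A : ∀ {l} → RightOfCommon B A l → RightOfCommon A B l
      B⇒A r i′ j′ e =
        incr A i′ _ (<-trans (common-index-< e) (pos-reflects-< B (r j′ i′ (sym e))))
      A-right : RightOfCommon A B j
      A-right i′ j′ e = incr A i′ j (<-≤-trans (common-index-< e) (maximal (i′ , e)))
      ¬B-right : ¬ RightOfCommon B A j
      ¬B-right r = <-irrefl refl (r j i (sym Aᵢ≡Bⱼ))

    more-before : #before A B < #before B A
    more-before with least-satisfying (λ i → Finₚ.any? λ j → val A i Finₚ.≟ val B j)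
                                      (proj₁ (proj₂ common) , proj₂ (proj₂ common))
    ... | i , (j , Aᵢ≡Bⱼ) , minimal =
      length-filter-< (leftOfCommon? A B) (leftOfCommon? B A) A⇒B (∈-allFin i) B-left ¬A-left
      where
      A⇒B : ∀ {l} → LeftOfCommon A B l → LeftOfCommon B A l
      A⇒B r j′ i′ e =
        incr B _ j′ (<-trans (pos-reflects-< A (r i′ j′ (sym e))) (common-index-< (sym e)))
      B-left : LeftOfCommon B A i
      B-left j′ i′ e = incr B i j′ (≤-<-trans (minimal (j′ , sym e)) (common-index-< (sym e)))
      ¬A-left : ¬ LeftOfCommon A B i
      ¬A-left r = <-irrefl refl (r i j Aᵢ≡Bⱼ)

  endpoints-not-common : ¬ ((∃ λ j → val B j ≡ val A (fromℕ K)) ⊎ (∃ λ i → val A i ≡ val B zero))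
  endpoints-not-common (inj₁ (j , e)) = <⇒≱ (common-index-< (sym e)) (Finₚ.≤fromℕ j)
  endpoints-not-common (inj₂ (i , e)) with common-index-< e
  ... | ()

proposition22 : (m n : ℕ) (π : Perm n) (A B : DecSub π (suc (suc m))) →
    IsASeq π A → IsBSeq π B →
    ((∃₂ λ i j → val A i ≡ val B j) → ¬ (∀ i → val A i ≡ val B i) →
       (#after B A < #after A B) × (#before A B < #before B A))
    × (((∃ λ j → val B j ≡ val A (fromℕ (suc m)))
        ⊎ (∃ λ i → val A i ≡ val B zero)) → ∀ i → val A i ≡ val B i)
proposition22 m n π A B isA isB =
  (λ common A≢B → more-after A≢B common , more-before A≢B common) ,
  λ endpoint → decidable-stable (Finₚ.all? λ i → val A i Finₚ.≟ val B i)
                                (λ A≢B → endpoints-not-common A≢B endpoint)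
  where open CommonLetters {A = A} {B} isA isB
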